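{- Let $f=f_1\cdots f_n$ be a restricted growth function over $[n]$, let $f'=f'_1\cdots f'_n$ be defined by $f'_i=f_i-u_i+\delta_i$, and let $\alpha(f)=1\cdot f'$ be the word of length $n+1$ obtained by prepending the letter $1$ to $f'$. Then $\alpha(f)\in T_{n+1}$.
   Context: A restricted growth function (RGF) over $[m]$ is a word $g=g_1\cdots g_m$ with $g_1=1$ and $g_i\le 1+\max\{g_1,\dots,g_{i-1}\}$ for $2\le i\le m$. $\operatorname{LrMax}(g)=\{i: g_i>g_j \text{ for all } j<i\}$. A letter of $f$ is unique if it occurs exactly once in $f$. Here $u_i$ is the number of positions $j<i$ with $j\in\operatorname{LrMax}(f)$, $f_j$ unique in $f$, and $f_j<f_i$; $\delta_i=1$ if $i\in\operatorname{LrMax}(f)$ and $f_i$ occurs more than once in $f$, else $\delta_i=0$. $T_{m}$ is the set of RGFs $g$ over $[m]$ such that for every $i\in\operatorname{LrMax}(g)$ with $g_i=s>1$ there is $j>i$ with $g_j=s-1$ (equivalently, the canonical forms of merging-free partitions of $[m]$, where the canonical form of $P=B_1/\cdots/B_k$ in block representation is the word $g$ with $j\in B_{g_j}$, and $P$ is merging-free if $\max B_i>\min B_{i+1}$ for all $i<k$). -}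

module Defs where

open import Data.Nat as ℕ using (ℕ; zero; suc; _∸_; _+_; _⊔_)
import Data.Nat.Properties as ℕP
open import Data.Fin as F using (Fin)
import Data.Fin.Properties as FP
open import Data.List using (List; length; filter; map; foldr)
open import Data.Product using (_×_; ∃-syntax)
open import Data.Vec.Functional using (Vector; _∷_)
open import Relation.Nullary using (Dec; yes; no; _→-dec_; _×-dec_; does)
open import Relation.Binary.PropositionalEquality using (_≡_)
open import Data.Bool using (if_then_else_)

-- Words of length n over positive integers are modelled as Fin n → ℕ;
-- positions are Fin n (0-based internally), ordered by F._<_ .

positions : (n : ℕ) → List (Fin n)
positions n = Data.List.allFin n
  where import Data.List

maxBefore : {n : ℕ} → (Fin n → ℕ) → Fin n → ℕ
maxBefore {n} g i = foldr _⊔_ 0 (map g (filter (λ j → j FP.<? i) (positions n)))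

-- restricted growth function over [n]: letters are positive and
-- g_i ≤ 1 + max{g_1,…,g_{i-1}}; for i = 1 this forces g_1 = 1.
IsRGF : {n : ℕ} → (Fin n → ℕ) → Set
IsRGF g = ∀ i → (1 ℕ.≤ g i) × (g i ℕ.≤ suc (maxBefore g i))

LrMax : {n : ℕ} → (Fin n → ℕ) → Fin n → Set
LrMax g i = ∀ j → j F.< i → g j ℕ.< g i

lrMax? : {n : ℕ} (g : Fin n → ℕ) (i : Fin n) → Dec (LrMax g i)
lrMax? g i = FP.all? (λ j → (j FP.<? i) →-dec (g j ℕP.<? g i))

occ : {n : ℕ} → (Fin n → ℕ) → ℕ → ℕ
occ {n} g a = length (filter (λ j → g j ℕP.≟ a) (positions n))

UniqueAt : {n : ℕ} → (Fin n → ℕ) → Fin n → Set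
UniqueAt g j = occ g (g j) ≡ 1

u : {n : ℕ} → (Fin n → ℕ) → Fin n → ℕ
u {n} f i = length (filter
  (λ j → (j FP.<? i) ×-dec (lrMax? f j ×-dec ((occ f (f j) ℕP.≟ 1) ×-dec (f j ℕP.<? f i))))
  (positions n))

δ : {n : ℕ} → (Fin n → ℕ) → Fin n → ℕ
δ f i = if does (lrMax? f i ×-dec (1 ℕP.<? occ f (f i))) then 1 else 0

f′ : {n : ℕ} → (Fin n → ℕ) → Fin n → ℕ
f′ f i = (f i ∸ u f i) + δ f i

α : {n : ℕ} → (Fin n → ℕ) → Fin (suc n) → ℕ
α f = 1 ∷ f′ f

InT : {m : ℕ} → (Fin m → ℕ) → Set
InT g = IsRGF g × (∀ i → LrMax g i → 1 ℕ.< g i → ∃[ j ] (i F.< j × g j ≡ g i ∸ 1))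

{-# OPTIONS --safe #-}
module Submission where

-- For f_i > 1 let j be the leftmost position with f_j = f_i - 1. The growth condition makes j a
-- left-to-right maximum, and the positions counted by u_i are those counted by u_j together with
-- j itself exactly when f_j is unique; as δ_j = 1 exactly when f_j is not unique, f_i - u_i = f'_j.
-- So each letter of f' exceeds an earlier letter of α(f) by at most one, and u_i < f_i keeps it
-- positive: α(f) is an RGF. If f'_i is a left-to-right maximum of α(f) above 1, then δ_i = 1, for
-- otherwise f'_i = f_i - u_i = f'_j with j earlier; hence f_i recurs at a later k, and there
-- u_k = u_i and δ_k = 0 give f'_k = f'_i - 1.

open import Defs
open import Data.Bool using (true; false; if_then_else_)
open import Data.Empty using (⊥-elim)
open import Data.Fin as F using (Fin)
import Data.Fin.Properties as FP
open import Data.List using (List; []; _∷_; length; filter; allFin)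
open import Data.List.Membership.Propositional using (_∈_)
open import Data.List.Membership.Propositional.Properties using (∈-allFin; ∈-map⁺; ∈-filter⁺; ∈-filter⁻)
open import Data.List.Properties using (filter-≐; filter-none; filter-some; foldr-preservesᵇ; foldr-preservesᵒ)
open import Data.List.Relation.Binary.Sublist.Propositional using (⊆-refl)
open import Data.List.Relation.Binary.Sublist.Propositional.Properties using (filter⁺; length-mono-≤)
import Data.List.Relation.Unary.All as All
open import Data.List.Relation.Unary.All.Properties using (map⁺)
open import Data.List.Relation.Unary.Any as Any using (here; there)
open import Data.List.Relation.Unary.Unique.Propositional using (Unique; _∷_)
open import Data.List.Relation.Unary.Unique.Propositional.Properties using (allFin⁺)
open import Data.Nat as ℕ using (ℕ; zero; suc; _∸_; _+_; _⊔_; z≤n; s≤s; _≤_; _<_)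
import Data.Nat.Properties as ℕP
open import Data.Product using (_×_; _,_; ∃-syntax; proj₁; proj₂)
open import Data.Sum using (_⊎_; inj₁; inj₂; [_,_])
open import Function using (_∘_)
open import Level using (0ℓ)
open import Relation.Binary.Definitions using (DecidableEquality)
open import Relation.Binary.PropositionalEquality using (_≡_; _≢_; refl; sym; trans; cong; cong₂; subst; module ≡-Reasoning)
open import Relation.Nullary using (does; yes; no; ¬_; _×-dec_; ¬?; contradiction)
open import Relation.Nullary.Decidable using (dec-true; dec-false)
open import Relation.Unary using (Pred; Decidable; _⊆_; _≐_; _∪_)

module _ {A : Set} where

  count-mono : {P Q : Pred A 0ℓ} (P? : Decidable P) (Q? : Decidable Q) → P ⊆ Q →
               ∀ xs → length (filter P? xs) ≤ length (filter Q? xs)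
  count-mono P? Q? P⊆Q xs = length-mono-≤ (filter⁺ P? Q? {as = xs} (λ { refl → P⊆Q }) ⊆-refl)

  count-⊎ : {P Q R : Pred A 0ℓ} (P? : Decidable P) (Q? : Decidable Q) (R? : Decidable R) →
            P ≐ Q ∪ R → (∀ {x} → Q x → ¬ R x) →
            ∀ xs → length (filter P? xs) ≡ length (filter Q? xs) + length (filter R? xs)
  count-⊎ P? Q? R? P≐Q∪R disjoint [] = refl
  count-⊎ P? Q? R? P≐Q∪R disjoint (x ∷ xs)
    with ih ← count-⊎ P? Q? R? P≐Q∪R disjoint xs | P? x | Q? x | R? x
  ... | no _   | no _   | no _   = ih
  ... | yes _  | yes _  | no _   = cong suc ih
  ... | yes _  | no _   | yes _  = trans (cong suc ih) (sym (ℕP.+-suc _ _))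
  ... | yes p  | no ¬q  | no ¬r  = ⊥-elim ([ ¬q , ¬r ] (proj₁ P≐Q∪R p))
  ... | _      | yes q  | yes r  = ⊥-elim (disjoint q r)
  ... | no ¬p  | yes q  | no _   = ⊥-elim (¬p (proj₂ P≐Q∪R (inj₁ q)))
  ... | no ¬p  | no _   | yes r  = ⊥-elim (¬p (proj₂ P≐Q∪R (inj₂ r)))

  count-≟-unique : (_≟_ : DecidableEquality A) {y : A} {xs : List A} →
                   Unique xs → y ∈ xs → length (filter (_≟ y) xs) ≡ 1
  count-≟-unique _≟_ {y} (x∉xs ∷ _) (here refl) with y ≟ y
  ... | yes _  = cong (suc ∘ length) (filter-none (_≟ y) (All.map (λ y≢z z≡y → y≢z (sym z≡y)) x∉xs))
  ... | no y≢y = contradiction refl y≢y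
  count-≟-unique _≟_ {y} {x ∷ _} (x∉xs ∷ xs-unique) (there y∈xs) with x ≟ y
  ... | yes refl = contradiction refl (All.lookup x∉xs y∈xs)
  ... | no _     = count-≟-unique _≟_ xs-unique y∈xs

count-≟-allFin : ∀ {n} (i : Fin n) → length (filter (FP._≟ i) (allFin n)) ≡ 1
count-≟-allFin {n} i = count-≟-unique FP._≟_ (allFin⁺ n) (∈-allFin i)

least-counterexample : ∀ {n p} (P : Pred (Fin n) p) → Decidable P → ∀ i → ¬ P i →
                       ∃[ j ] (j F.≤ i × ¬ P j × (∀ k → k F.< j → P k))
least-counterexample {n} P P? i ¬Pi with FP.¬∀⟶∃¬-smallest n P P? (λ ∀P → ¬Pi (∀P i))
... | j , ¬Pj , below = j , ℕP.≮⇒≥ (λ i<j → ¬Pi (P-below i<j)) , ¬Pj , λ k → P-below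
  where
  P-below : ∀ {k} → k F.< j → P k
  P-below {k} k<j = subst P inject-fromℕ< (below (F.fromℕ< k<j))
    where
    inject-fromℕ< : F.inject (F.fromℕ< k<j) ≡ k
    inject-fromℕ< = FP.toℕ-injective (trans (FP.toℕ-inject (F.fromℕ< k<j)) (FP.toℕ-fromℕ< k<j))

module _ {n : ℕ} (g : Fin n → ℕ) where

  ≤-maxBefore : ∀ {i k} → k F.< i → g k ≤ maxBefore g i
  ≤-maxBefore {i} {k} k<i = foldr-preservesᵒ {P = g k ≤_} pres 0 _
    (inj₂ (Any.map ℕP.≤-reflexive (∈-map⁺ g (∈-filter⁺ (FP._<? i) (∈-allFin k) k<i))))
    where
    pres : ∀ x y → g k ≤ x ⊎ g k ≤ y → g k ≤ x ⊔ y
    pres x y (inj₁ le) = ℕP.≤-trans le (ℕP.m≤m⊔n x y)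
    pres x y (inj₂ le) = ℕP.≤-trans le (ℕP.m≤n⊔m x y)

  maxBefore-< : ∀ {i v} → 0 < v → (∀ k → k F.< i → g k < v) → maxBefore g i < v
  maxBefore-< {i} {v} 0<v below = foldr-preservesᵇ {P = _< v} ℕP.⊔-pres-<m 0<v
    (map⁺ (All.tabulate {xs = filter (FP._<? i) (allFin n)}
      λ k∈ → below _ (proj₂ (∈-filter⁻ (FP._<? i) {xs = allFin n} k∈))))

module _ {n : ℕ} (f : Fin n → ℕ) where

  lrMax-first : ∀ {i k} → LrMax f i → f k ≡ f i → i F.≤ k
  lrMax-first Li fk≡fi = ℕP.≮⇒≥ (λ k<i → ℕP.<-irrefl fk≡fi (Li _ k<i))

  lrMax-injective : ∀ {j k} → LrMax f j → LrMax f k → f j ≡ f k → j ≡ k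
  lrMax-injective Lj Lk fj≡fk = FP.≤-antisym (lrMax-first Lj (sym fj≡fk)) (lrMax-first Lk fj≡fk)

  lrMax-precedes : ∀ {i k} → LrMax f k → f k < f i → k F.< i
  lrMax-precedes {i} Lk fk<fi =
    ℕP.≤∧≢⇒< (ℕP.≮⇒≥ (λ i<k → ℕP.<-asym fk<fi (Lk i i<k)))
             (λ k≡i → ℕP.<-irrefl (cong f (FP.toℕ-injective k≡i)) fk<fi)

  RepeatedMax : Pred (Fin n) 0ℓ
  RepeatedMax i = LrMax f i × 1 < occ f (f i)

  repeatedMax? : Decidable RepeatedMax
  repeatedMax? i = lrMax? f i ×-dec (1 ℕP.<? occ f (f i))

  δ-repeatedMax : ∀ {i} → RepeatedMax i → δ f i ≡ 1
  δ-repeatedMax {i} r = cong (if_then 1 else 0) (dec-true (repeatedMax? i) r)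

  δ-otherwise : ∀ {i} → ¬ RepeatedMax i → δ f i ≡ 0
  δ-otherwise {i} ¬r = cong (if_then 1 else 0) (dec-false (repeatedMax? i) ¬r)

  δ≤1 : ∀ i → δ f i ≤ 1
  δ≤1 i with does (repeatedMax? i)
  ... | true  = ℕP.≤-refl
  ... | false = z≤n

  occ-pos : ∀ i → 0 < occ f (f i)
  occ-pos i = filter-some (λ k → f k ℕP.≟ f i) (Any.map (λ i≡k → cong f (sym i≡k)) (∈-allFin i))

  another-occurrence : ∀ i → 1 < occ f (f i) → ∃[ k ] (k ≢ i × f k ≡ f i)
  another-occurrence i repeated with FP.any? (λ k → ¬? (k FP.≟ i) ×-dec (f k ℕP.≟ f i))
  ... | yes found = found
  ... | no none = ⊥-elim (ℕP.<⇒≱ repeated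
                    (ℕP.≤-trans (count-mono _ (FP._≟ i) only-i (allFin n)) (ℕP.≤-reflexive (count-≟-allFin i))))
    where
    only-i : ∀ {k} → f k ≡ f i → k ≡ i
    only-i {k} fk≡fi with k FP.≟ i
    ... | yes k≡i = k≡i
    ... | no k≢i  = contradiction (k , k≢i , fk≡fi) none

  -- counted? i is verbatim the filter predicate of u, so u f i is definitionally a count over it.
  Counted : Fin n → Pred (Fin n) 0ℓ
  Counted i j = j F.< i × (LrMax f j × (UniqueAt f j × f j < f i))

  counted? : ∀ i → Decidable (Counted i)
  counted? i j = (j FP.<? i) ×-dec (lrMax? f j ×-dec ((occ f (f j) ℕP.≟ 1) ×-dec (f j ℕP.<? f i)))

  module _ {i j : Fin n} (j<i : j F.< i) (Lj : LrMax f j) (fi≡ : suc (f j) ≡ f i) where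

    fj<fi : f j < f i
    fj<fi = ℕP.≤-reflexive fi≡

    counted-below : Counted j ⊆ Counted i
    counted-below (k<j , Lk , Uk , fk<fj) = FP.<-trans k<j j<i , Lk , Uk , ℕP.<-trans fk<fj fj<fi

    counted-above : Counted i ⊆ Counted j ∪ (_≡ j)
    counted-above {k} (k<i , Lk , Uk , fk<fi)
      with ℕP.m≤n⇒m<n∨m≡n (ℕP.≤-pred (subst (suc (f k) ≤_) (sym fi≡) fk<fi))
    ... | inj₁ fk<fj = inj₁ (lrMax-precedes Lk fk<fj , Lk , Uk , fk<fj)
    ... | inj₂ fk≡fj = inj₂ (lrMax-injective Lk Lj fk≡fj)

    u-step-unique : UniqueAt f j → u f i ≡ suc (u f j)
    u-step-unique Uj = begin
      u f i                                         ≡⟨ count-⊎ (counted? i) (counted? j) (FP._≟ j) split disjoint (allFin n) ⟩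
      u f j + length (filter (FP._≟ j) (allFin n))  ≡⟨ cong (u f j +_) (count-≟-allFin j) ⟩
      u f j + 1                                     ≡⟨ ℕP.+-comm (u f j) 1 ⟩
      suc (u f j)                                   ∎
      where
      open ≡-Reasoning
      split : Counted i ≐ Counted j ∪ (_≡ j)
      split = counted-above , [ counted-below , (λ { refl → j<i , Lj , Uj , fj<fi }) ]
      disjoint : ∀ {k} → Counted j k → k ≢ j
      disjoint (k<j , _) refl = FP.<-irrefl refl k<j

    u-step-repeated : ¬ UniqueAt f j → u f i ≡ u f j
    u-step-repeated ¬Uj =
      cong length (filter-≐ (counted? i) (counted? j) (counted-i⊆j , counted-below) (allFin n))
      where
      counted-i⊆j : Counted i ⊆ Counted j
      counted-i⊆j c with counted-above c
      ... | inj₁ cj   = cj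
      ... | inj₂ refl = contradiction (proj₁ (proj₂ (proj₂ c))) ¬Uj

    u-step-≤ : u f i ≤ suc (u f j)
    u-step-≤ with occ f (f j) ℕP.≟ 1
    ... | yes Uj  = ℕP.≤-reflexive (u-step-unique Uj)
    ... | no ¬Uj  = ℕP.m≤n⇒m≤1+n (ℕP.≤-reflexive (u-step-repeated ¬Uj))

  u-repeat : ∀ {i k} → LrMax f i → i F.< k → f k ≡ f i → u f k ≡ u f i
  u-repeat {i} {k} Li i<k fk≡fi =
    cong length (filter-≐ (counted? k) (counted? i) (counted-k⊆i , counted-i⊆k) (allFin n))
    where
    counted-k⊆i : Counted k ⊆ Counted i
    counted-k⊆i {m} (_ , Lm , Um , fm<fk) =
      let fm<fi = subst (f m <_) fk≡fi fm<fk in lrMax-precedes Lm fm<fi , Lm , Um , fm<fi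
    counted-i⊆k : Counted i ⊆ Counted k
    counted-i⊆k {m} (m<i , Lm , Um , fm<fi) = FP.<-trans m<i i<k , Lm , Um , subst (f m <_) (sym fk≡fi) fm<fi

  f′≤suc[f∸u] : ∀ i → f′ f i ≤ suc (f i ∸ u f i)
  f′≤suc[f∸u] i = ℕP.≤-trans (ℕP.+-monoʳ-≤ (f i ∸ u f i) (δ≤1 i)) (ℕP.≤-reflexive (ℕP.+-comm _ 1))

  f′-unrepeated : ∀ {i} → ¬ RepeatedMax i → f′ f i ≡ f i ∸ u f i
  f′-unrepeated {i} ¬repeated = trans (cong (f i ∸ u f i +_) (δ-otherwise ¬repeated)) (ℕP.+-identityʳ _)

  f′-descends-at-repeat : ∀ {i} → RepeatedMax i → ∃[ k ] (i F.< k × f′ f k ≡ f′ f i ∸ 1)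
  f′-descends-at-repeat {i} r@(Li , repeated) with another-occurrence i repeated
  ... | k , k≢i , fk≡fi = k , i<k , (begin
    f′ f k                  ≡⟨ f′-unrepeated (λ (Lk , _) → ℕP.<-irrefl (sym fk≡fi) (Lk i i<k)) ⟩
    f k ∸ u f k             ≡⟨ cong₂ _∸_ fk≡fi (u-repeat Li i<k fk≡fi) ⟩
    f i ∸ u f i             ≡⟨ sym (ℕP.m+n∸n≡m _ 1) ⟩
    (f i ∸ u f i) + 1 ∸ 1   ≡⟨ cong (λ d → (f i ∸ u f i) + d ∸ 1) (sym (δ-repeatedMax r)) ⟩
    f′ f i ∸ 1              ∎)
    where
    open ≡-Reasoning
    i<k : i F.< k
    i<k = FP.≤∧≢⇒< (lrMax-first Li fk≡fi) (k≢i ∘ sym)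

  module _ (rgf : IsRGF f) where

    first-occurrence : ∀ {v} i → 0 < v → v ≤ f i → ∃[ j ] (j F.≤ i × f j ≡ v × LrMax f j)
    first-occurrence {v} i 0<v v≤fi with least-counterexample (λ k → f k < v) (λ k → f k ℕP.<? v) i (ℕP.≤⇒≯ v≤fi)
    ... | j , j≤i , fj≮v , below = j , j≤i , fj≡v , λ k k<j → subst (f k <_) (sym fj≡v) (below k k<j)
      where
      fj≡v : f j ≡ v
      fj≡v = ℕP.≤-antisym (ℕP.≤-trans (proj₂ (rgf j)) (maxBefore-< f 0<v below)) (ℕP.≮⇒≥ fj≮v)

    lrMax-predecessor : ∀ i → 1 < f i → ∃[ j ] (j F.< i × LrMax f j × suc (f j) ≡ f i)
    lrMax-predecessor i 1<fi with first-occurrence i (ℕP.pred-mono-≤ 1<fi) ℕP.pred[n]≤n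
    ... | j , j≤i , fj≡ , Lj = j , FP.≤∧≢⇒< j≤i (λ { refl → ℕP.1+n≢n fi≡ }) , Lj , fi≡
      where
      fi≡ : suc (f j) ≡ f i
      fi≡ = trans (cong suc fj≡) (ℕP.suc-pred (f i) {{ℕ.>-nonZero (ℕP.<⇒≤ 1<fi)}})

    u<letter : ∀ a i → f i ≡ a → u f i < a
    u<letter zero i fi≡0 = contradiction (proj₁ (rgf i)) (ℕP.<-irrefl (sym fi≡0))
    u<letter (suc zero) i fi≡1 =
      s≤s (ℕP.≤-reflexive (cong length (filter-none (counted? i) (All.universal uncounted (allFin n)))))
      where
      uncounted : ∀ k → ¬ Counted i k
      uncounted k (_ , _ , _ , fk<fi) = ℕP.<⇒≱ (subst (f k <_) fi≡1 fk<fi) (proj₁ (rgf k))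
    u<letter (suc (suc b)) i fi≡ =
      let j , j<i , Lj , fj+1≡fi = lrMax-predecessor i (subst (1 <_) (sym fi≡) (s≤s (s≤s z≤n)))
      in s≤s (ℕP.≤-trans (u-step-≤ j<i Lj fj+1≡fi) (u<letter (suc b) j (ℕP.suc-injective (trans fj+1≡fi fi≡))))

    u<f : ∀ i → u f i < f i
    u<f i = u<letter (f i) i refl

    f∸u≡f′-predecessor : ∀ {i j} → j F.< i → LrMax f j → suc (f j) ≡ f i → f i ∸ u f i ≡ f′ f j
    f∸u≡f′-predecessor {i} {j} j<i Lj fi≡ with occ f (f j) ℕP.≟ 1
    ... | yes Uj = begin
      f i ∸ u f i           ≡⟨ cong₂ _∸_ (sym fi≡) (u-step-unique j<i Lj fi≡ Uj) ⟩
      f j ∸ u f j           ≡⟨ f′-unrepeated (λ (_ , repeated) → ℕP.<-irrefl (sym Uj) repeated) ⟨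
      f′ f j                ∎
      where open ≡-Reasoning
    ... | no ¬Uj = begin
      f i ∸ u f i           ≡⟨ cong₂ _∸_ (sym fi≡) (u-step-repeated j<i Lj fi≡ ¬Uj) ⟩
      suc (f j) ∸ u f j     ≡⟨ ℕP.+-∸-assoc 1 (ℕP.<⇒≤ (u<f j)) ⟩
      suc (f j ∸ u f j)     ≡⟨ ℕP.+-comm 1 _ ⟩
      (f j ∸ u f j) + 1     ≡⟨ cong (f j ∸ u f j +_) (δ-repeatedMax (Lj , ℕP.≤∧≢⇒< (occ-pos j) (¬Uj ∘ sym))) ⟨
      f′ f j                ∎
      where open ≡-Reasoning

    f∸u-earlier : ∀ i → 1 < f i → ∃[ j ] (j F.< i × f i ∸ u f i ≡ f′ f j)
    f∸u-earlier i 1<fi with lrMax-predecessor i 1<fi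
    ... | j , j<i , Lj , fi≡ = j , j<i , f∸u≡f′-predecessor j<i Lj fi≡

    f′-positive : ∀ i → 0 < f′ f i
    f′-positive i = ℕP.≤-trans (ℕP.m<n⇒0<n∸m (u<f i)) (ℕP.m≤m+n _ (δ f i))

    f′-bounded-by-earlier : ∀ i → ∃[ k ] (k F.< F.suc i × f′ f i ≤ suc (α f k))
    f′-bounded-by-earlier i with f i ℕP.≤? 1
    ... | yes fi≤1 =
      F.zero , s≤s z≤n , ℕP.≤-trans (f′≤suc[f∸u] i) (s≤s (ℕP.≤-trans (ℕP.m∸n≤m (f i) (u f i)) fi≤1))
    ... | no fi≰1 with f∸u-earlier i (ℕP.≰⇒> fi≰1)
    ...   | j , j<i , f∸u≡ = F.suc j , s≤s j<i , subst (λ x → f′ f i ≤ suc x) f∸u≡ (f′≤suc[f∸u] i)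

    α-isRGF : IsRGF (α f)
    α-isRGF F.zero = s≤s z≤n , s≤s z≤n
    α-isRGF (F.suc i) with f′-bounded-by-earlier i
    ... | k , k<i+1 , f′≤ = f′-positive i , ℕP.≤-trans f′≤ (s≤s (≤-maxBefore (α f) k<i+1))

    f′-repeats-earlier : ∀ {i} → ¬ RepeatedMax i → 1 < f′ f i → ∃[ j ] (j F.< i × f′ f j ≡ f′ f i)
    f′-repeats-earlier {i} ¬repeated 1<f′i
      with f∸u-earlier i (ℕP.<-≤-trans (subst (1 <_) (f′-unrepeated ¬repeated) 1<f′i) (ℕP.m∸n≤m (f i) (u f i)))
    ... | j , j<i , f∸u≡ = j , j<i , trans (sym f∸u≡) (sym (f′-unrepeated ¬repeated))

    α-descends : ∀ i → LrMax (α f) i → 1 < α f i → ∃[ j ] (i F.< j × α f j ≡ α f i ∸ 1)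
    α-descends F.zero _ (s≤s ())
    α-descends (F.suc i) Lα 1<f′i with repeatedMax? i
    ... | yes r with f′-descends-at-repeat r
    ...   | k , i<k , f′k≡ = F.suc k , s≤s i<k , f′k≡
    α-descends (F.suc i) Lα 1<f′i | no ¬repeated with f′-repeats-earlier ¬repeated 1<f′i
    ...   | j , j<i , f′j≡f′i = contradiction (Lα (F.suc j) (s≤s j<i)) (ℕP.<-irrefl f′j≡f′i)

lemma16 : (n : ℕ) (f : Fin n → ℕ) → IsRGF f → InT {suc n} (α f)
lemma16 n f rgf = α-isRGF f rgf , α-descends f rgf
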